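{- Let $G=(S,T;E)$ with $S=\{s_1,\dots,s_n\}$ and let $d=|T|$. Then the linear program (LP2) is integral.
   Context: $G$ is a finite bipartite graph without loops or parallel edges; the nodes of $S$ are in the fixed order $s_1,\dots,s_n$. $\Delta(v)$ is the set of edges incident to $v$, and $R_d(s_i)=\{s_i,\dots,s_{\min(i+d-1,n)}\}$. (LP2), for a weight function $w:E\to\mathbb R_+$, is: maximize $\sum_{st\in E}w_{st}x_{st}$ subject to $x\in\mathbb R_+^E$, $\sum_{st\in\Delta(s)}x_{st}=1$ for all $s\in S$, and $\sum_{s't\in E:\,s'\in R_d(s)}x_{s't}\le1$ for all $s\in S,t\in T$. Integral means every vertex of its feasible region is an integer vector (equivalently, its optimum, when finite, is attained by an integral solution, which corresponds to a perfect $d$-distance matching).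
   Formalization: The points of the feasible region of (LP2), both the vertices tested and the points in their convex combinations, have rational rather than real coordinates. -}

module Defs where

open import Data.Bool using (Bool; true; false; if_then_else_)
open import Data.Nat as ℕ using (ℕ; zero; suc)
open import Data.Fin using (Fin; toℕ) renaming (zero to fzero; suc to fsuc)
open import Data.Integer using (ℤ)
open import Data.Rational using (ℚ; 0ℚ; 1ℚ; _+_; _*_; _-_; _≤_; _<_; _/_)
open import Data.Product using (_×_; Σ; ∃)
open import Relation.Nullary using (does)
open import Relation.Binary.PropositionalEquality using (_≡_)

-- A finite bipartite graph G = (S, T; E) with S = {s_0,…,s_{n-1}} (in this
-- fixed order) and T = {t_0,…,t_{m-1}}: the edge set is given by an
-- adjacency relation; this automatically excludes loops and parallel edges.
record BipGraph : Set where
  field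
    nS  : ℕ
    nT  : ℕ
    adj : Fin nS → Fin nT → Bool
open BipGraph public

sumFin : (n : ℕ) → (Fin n → ℚ) → ℚ
sumFin zero    f = 0ℚ
sumFin (suc n) f = f fzero + sumFin n (λ i → f (fsuc i))

-- Vectors x ∈ ℚ^E, represented as functions on S × T that vanish off E.
Vect : BipGraph → Set
Vect G = Fin (nS G) → Fin (nT G) → ℚ

SupportedOnE : (G : BipGraph) → Vect G → Set
SupportedOnE G x = ∀ s t → adj G s t ≡ false → x s t ≡ 0ℚ

onE : (G : BipGraph) → Fin (nS G) → Fin (nT G) → ℚ → ℚ
onE G s t q = if adj G s t then q else 0ℚ

-- s_j ∈ R_d(s_i) = {s_i,…,s_{min(i+d-1,n)}}  (0-indexed: i ≤ j < i + d)
inWindow : ℕ → ℕ → ℕ → Bool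
inWindow d i j = does (i ℕ.≤? j) Data.Bool.∧ does (j ℕ.<? i ℕ.+ d)
  where import Data.Bool

FeasibleLP2 : (G : BipGraph) → ℕ → Vect G → Set
FeasibleLP2 G d x =
    SupportedOnE G x
  × (∀ s t → 0ℚ ≤ x s t)
  × (∀ s → sumFin (nT G) (λ t → onE G s t (x s t)) ≡ 1ℚ)
  × (∀ (s : Fin (nS G)) t → sumFin (nS G) (λ s' →
        if inWindow d (toℕ s) (toℕ s') then onE G s' t (x s' t) else 0ℚ) ≤ 1ℚ)

IsVertex : (G : BipGraph) → (Vect G → Set) → Vect G → Set
IsVertex G P x =
  P x ×
  (∀ y z (λ' : ℚ) → P y → P z → 0ℚ < λ' → λ' < 1ℚ →
     (∀ s t → x s t ≡ λ' * y s t + (1ℚ - λ') * z s t) →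
     ∀ s t → y s t ≡ x s t)

IsIntegral : (G : BipGraph) → Vect G → Set
IsIntegral G x = ∀ s t → Σ ℤ (λ k → x s t ≡ k / (suc zero))

LP2Integral : (G : BipGraph) → ℕ → Set
LP2Integral G d = ∀ x → IsVertex G (FeasibleLP2 G d) x → IsIntegral G x

module Submission where

-- Let x be a vertex of (LP2) with d = |T| = m, and suppose x_st is fractional.  If n < m, the
-- window starting at s_1 contains every row, so x lies in the bipartite matching polytope:
-- rows sum to 1 and columns to at most 1.  If n ≥ m, every window of m consecutive rows carries
-- mass m on m columns of capacity 1, so each of its column sums is exactly 1; sliding such a
-- window by one row shows x_{s+m} = x_s, so x is the periodic extension of its first m rows X,
-- again a point of the matching polytope.  In both cases the fractional entries of X contain an
-- alternating cycle, or an alternating path between columns that are not full.  Adding ±ε times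
-- the signed indicator of its edges (repeated periodically) keeps rows, full columns and hence
-- all windows feasible for small ε > 0, so x is the midpoint of two feasible points.

open import Defs
open import Data.Bool using (Bool; true; false; if_then_else_; _∧_; T)
import Data.Bool.Properties as 𝔹ₚ
open import Data.Empty using (⊥; ⊥-elim)
open import Data.Fin as F using (Fin; toℕ) renaming (zero to fzero; suc to fsuc)
import Data.Fin.Properties as Fₚ
import Data.Integer as ℤ
open import Data.Nat as ℕ using (ℕ; zero; suc; _∸_; _%_)
import Data.Nat.DivMod as ℕ
import Data.Nat.Properties as ℕₚ
open import Data.Product using (Σ; Σ-syntax; ∃-syntax; _×_; _,_; proj₁; proj₂)
open import Data.Rational as ℚ using (ℚ; 0ℚ; 1ℚ; ½; _+_; _*_; _-_; -_; _≤_; _<_; _⊓_; 1/_)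
import Data.Rational.Properties as ℚₚ
open import Data.Rational.Solver using (module +-*-Solver)
open import Data.Sum using (_⊎_; inj₁; inj₂; [_,_]′)
import Data.Sum.Properties as ⊎ₚ
open import Data.Unit using (tt)
open import Function using (_∘_)
open import Relation.Binary.Definitions using (tri<; tri≈; tri>)
open import Relation.Binary.PropositionalEquality
open import Relation.Nullary using (Dec; yes; no; ¬_; does)
open import Relation.Nullary.Decidable
  using (decidable-stable; ¬?; _×-dec_; _⊎-dec_; dec-true; dec-false; toWitness)

open +-*-Solver

Minimal : (ℕ → Set) → ℕ → Set
Minimal P j = P j × (∀ k → k ℕ.< j → ¬ P k)

minimal-or-none-below : ∀ {P : ℕ → Set} → (∀ n → Dec (P n)) → ∀ m →
  (∃[ j ] Minimal P j) ⊎ (∀ k → k ℕ.< m → ¬ P k)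
minimal-or-none-below P? zero = inj₂ (λ _ ())
minimal-or-none-below P? (suc m) with minimal-or-none-below P? m | P? m
... | inj₁ found | _ = inj₁ found
... | inj₂ none | yes pm = inj₁ (m , pm , none)
... | inj₂ none | no ¬pm = inj₂ λ k k<1+m →
  [ none k , (λ { refl → ¬pm }) ]′ (ℕₚ.m<1+n⇒m<n∨m≡n k<1+m)

minimal-witness : ∀ {P : ℕ → Set} → (∀ n → Dec (P n)) → ∀ {n} → P n → ∃[ j ] Minimal P j
minimal-witness P? {n} pn with minimal-or-none-below P? (suc n)
... | inj₁ found = found
... | inj₂ none = ⊥-elim (none n (ℕₚ.n<1+n n) pn)

≡ᵇ-true⇒≡ : ∀ {i k} → (i ℕ.≡ᵇ k) ≡ true → i ≡ k
≡ᵇ-true⇒≡ {i} {k} e = ℕₚ.≡ᵇ⇒≡ i k (subst T (sym e) tt)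

≡⇒≡ᵇ-true : ∀ {i k} → i ≡ k → (i ℕ.≡ᵇ k) ≡ true
≡⇒≡ᵇ-true {zero} refl = refl
≡⇒≡ᵇ-true {suc i} refl = ≡⇒≡ᵇ-true {i} refl

≢⇒≡ᵇ-false : ∀ {i k} → i ≢ k → (i ℕ.≡ᵇ k) ≡ false
≢⇒≡ᵇ-false {i} {k} i≢k with i ℕ.≡ᵇ k in eq
... | true = ⊥-elim (i≢k (≡ᵇ-true⇒≡ eq))
... | false = refl

_==_ : ∀ {n} → Fin n → Fin n → Bool
i == j = toℕ i ℕ.≡ᵇ toℕ j

==⇒≡ : ∀ {n} {i j : Fin n} → (i == j) ≡ true → i ≡ j
==⇒≡ e = Fₚ.toℕ-injective (≡ᵇ-true⇒≡ e)

==-refl : ∀ {n} (i : Fin n) → (i == i) ≡ true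
==-refl i = ≡⇒≡ᵇ-true {toℕ i} refl

Fractional : ℚ → Set
Fractional q = 0ℚ < q × q < 1ℚ

0≤1 : 0ℚ ≤ 1ℚ
0≤1 = ℚₚ.≤ᵇ⇒≤ tt

0<1 : 0ℚ < 1ℚ
0<1 = ℚₚ.positive⁻¹ 1ℚ

≤∧≢⇒< : ∀ {p q} → p ≤ q → p ≢ q → p < q
≤∧≢⇒< {p} {q} p≤q p≢q with p ℚ.<? q
... | yes p<q = p<q
... | no p≮q = ⊥-elim (p≢q (ℚₚ.≤-antisym p≤q (ℚₚ.≮⇒≥ p≮q)))

unit-interval-not-fractional : ∀ {q} → 0ℚ ≤ q → q ≤ 1ℚ → ¬ Fractional q → q ≡ 0ℚ ⊎ q ≡ 1ℚ
unit-interval-not-fractional {q} 0≤q q≤1 ¬frac with q ℚₚ.≟ 0ℚ | q ℚₚ.≟ 1ℚ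
... | yes q≡0 | _ = inj₁ q≡0
... | no _ | yes q≡1 = inj₂ q≡1
... | no q≢0 | no q≢1 = ⊥-elim (¬frac (≤∧≢⇒< 0≤q (q≢0 ∘ sym) , ≤∧≢⇒< q≤1 q≢1))

≤-+ˡ : ∀ {a b} → 0ℚ ≤ a → b ≤ a + b
≤-+ˡ {a} {b} 0≤a = subst (_≤ a + b) (ℚₚ.+-identityˡ b) (ℚₚ.+-mono-≤ 0≤a (ℚₚ.≤-refl {b}))

≤-+ʳ : ∀ {a b} → 0ℚ ≤ b → a ≤ a + b
≤-+ʳ {a} {b} 0≤b = subst (_≤ a + b) (ℚₚ.+-identityʳ a) (ℚₚ.+-mono-≤ (ℚₚ.≤-refl {a}) 0≤b)

p<q⇒0<q-p : ∀ {p q} → p < q → 0ℚ < q - p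
p<q⇒0<q-p {p} {q} p<q = subst (_< q - p) (ℚₚ.+-inverseʳ p) (ℚₚ.+-monoˡ-< (- p) p<q)

neg-involutive : ∀ p → - (- p) ≡ p
neg-involutive = solve 1 (λ p → :- (:- p) := p) refl

*-monoˡ-≤-nonNeg : ∀ {r p q} → 0ℚ ≤ r → p ≤ q → r * p ≤ r * q
*-monoˡ-≤-nonNeg {r} 0≤r = ℚₚ.*-monoˡ-≤-nonNeg r {{ℚ.nonNegative 0≤r}}

+-cancelˡ : ∀ c p q → c + p ≡ c + q → p ≡ q
+-cancelˡ c p q e = begin
  p             ≡⟨ solve 2 (λ c p → p := (c :+ p) :- c) refl c p ⟩
  (c + p) - c   ≡⟨ cong (_- c) e ⟩
  (c + q) - c   ≡⟨ solve 2 (λ c q → (c :+ q) :- c := q) refl c q ⟩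
  q             ∎
  where open ≡-Reasoning

+-cancelʳ : ∀ a b q → a + q ≡ b + q → a ≡ b
+-cancelʳ a b q e = +-cancelˡ q a b (trans (ℚₚ.+-comm q a) (trans e (ℚₚ.+-comm b q)))

*-cancel-pos : ∀ e d → 0ℚ < e → e * d ≡ 0ℚ → d ≡ 0ℚ
*-cancel-pos e d 0<e e*d≡0 = begin
  d                ≡⟨ sym (ℚₚ.*-identityˡ d) ⟩
  1ℚ * d           ≡⟨ cong (_* d) (sym (ℚₚ.*-inverseˡ e)) ⟩
  (1/ e * e) * d   ≡⟨ ℚₚ.*-assoc (1/ e) e d ⟩
  1/ e * (e * d)   ≡⟨ cong (1/ e *_) e*d≡0 ⟩
  1/ e * 0ℚ        ≡⟨ ℚₚ.*-zeroʳ (1/ e) ⟩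
  0ℚ               ∎
  where
  open ≡-Reasoning
  instance
    e≢0 : ℚ.NonZero e
    e≢0 = ℚₚ.pos⇒nonZero e {{ℚ.positive 0<e}}

⊓-pos : ∀ {p q} → 0ℚ < p → 0ℚ < q → 0ℚ < p ⊓ q
⊓-pos {p} {q} 0<p 0<q with ℚₚ.⊓-sel p q
... | inj₁ p⊓q≡p = subst (0ℚ <_) (sym p⊓q≡p) 0<p
... | inj₂ p⊓q≡q = subst (0ℚ <_) (sym p⊓q≡q) 0<q

bit-difference-bounded : ∀ {x y} → x ≡ 0ℚ ⊎ x ≡ 1ℚ → y ≡ 0ℚ ⊎ y ≡ 1ℚ →
  - 1ℚ ≤ x - y × x - y ≤ 1ℚ
bit-difference-bounded (inj₁ refl) (inj₁ refl) = ℚₚ.≤ᵇ⇒≤ tt , ℚₚ.≤ᵇ⇒≤ tt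
bit-difference-bounded (inj₁ refl) (inj₂ refl) = ℚₚ.≤ᵇ⇒≤ tt , ℚₚ.≤ᵇ⇒≤ tt
bit-difference-bounded (inj₂ refl) (inj₁ refl) = ℚₚ.≤ᵇ⇒≤ tt , ℚₚ.≤ᵇ⇒≤ tt
bit-difference-bounded (inj₂ refl) (inj₂ refl) = ℚₚ.≤ᵇ⇒≤ tt , ℚₚ.≤ᵇ⇒≤ tt

ℕ→ℚ : ℕ → ℚ
ℕ→ℚ zero = 0ℚ
ℕ→ℚ (suc n) = 1ℚ + ℕ→ℚ n

ℕ→ℚ-nonNeg : ∀ n → 0ℚ ≤ ℕ→ℚ n
ℕ→ℚ-nonNeg zero = ℚₚ.≤-refl
ℕ→ℚ-nonNeg (suc n) = ℚₚ.≤-trans (ℕ→ℚ-nonNeg n) (≤-+ˡ 0≤1)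

sumFin-cong : ∀ n {f g : Fin n → ℚ} → (∀ i → f i ≡ g i) → sumFin n f ≡ sumFin n g
sumFin-cong zero f≗g = refl
sumFin-cong (suc n) f≗g = cong₂ _+_ (f≗g fzero) (sumFin-cong n (f≗g ∘ fsuc))

sumFin-zero : ∀ n {f : Fin n → ℚ} → (∀ i → f i ≡ 0ℚ) → sumFin n f ≡ 0ℚ
sumFin-zero zero f≗0 = refl
sumFin-zero (suc n) f≗0 =
  trans (cong₂ _+_ (f≗0 fzero) (sumFin-zero n (f≗0 ∘ fsuc))) (ℚₚ.+-identityˡ 0ℚ)

sumFin-+ : ∀ n (f g : Fin n → ℚ) → sumFin n (λ i → f i + g i) ≡ sumFin n f + sumFin n g
sumFin-+ zero f g = refl
sumFin-+ (suc n) f g = trans (cong (f fzero + g fzero +_) (sumFin-+ n (f ∘ fsuc) (g ∘ fsuc)))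
  (solve 4 (λ a b c d → (a :+ b) :+ (c :+ d) := (a :+ c) :+ (b :+ d)) refl
     (f fzero) (g fzero) (sumFin n (f ∘ fsuc)) (sumFin n (g ∘ fsuc)))

sumFin-neg : ∀ n (f : Fin n → ℚ) → sumFin n (λ i → - f i) ≡ - sumFin n f
sumFin-neg zero f = refl
sumFin-neg (suc n) f = trans (cong (- f fzero +_) (sumFin-neg n (f ∘ fsuc)))
  (sym (ℚₚ.neg-distrib-+ (f fzero) (sumFin n (f ∘ fsuc))))

sumFin-*ˡ : ∀ n c (f : Fin n → ℚ) → sumFin n (λ i → c * f i) ≡ c * sumFin n f
sumFin-*ˡ zero c f = sym (ℚₚ.*-zeroʳ c)
sumFin-*ˡ (suc n) c f = trans (cong (c * f fzero +_) (sumFin-*ˡ n c (f ∘ fsuc)))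
  (sym (ℚₚ.*-distribˡ-+ c (f fzero) (sumFin n (f ∘ fsuc))))

sumFin-comm : ∀ n m (f : Fin n → Fin m → ℚ) →
  sumFin n (λ i → sumFin m (f i)) ≡ sumFin m (λ j → sumFin n (λ i → f i j))
sumFin-comm zero m f = sym (sumFin-zero m (λ _ → refl))
sumFin-comm (suc n) m f = trans (cong (sumFin m (f fzero) +_) (sumFin-comm n m (f ∘ fsuc)))
  (sym (sumFin-+ m (f fzero) (λ j → sumFin n (λ i → f (fsuc i) j))))

sumFin-if : ∀ n (c : Bool) (f : Fin n → ℚ) →
  sumFin n (λ i → if c then f i else 0ℚ) ≡ (if c then sumFin n f else 0ℚ)
sumFin-if n true f = refl
sumFin-if n false f = sumFin-zero n (λ _ → refl)

sumFin-select : ∀ n (f : Fin n → ℚ) (i : Fin n) →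
  sumFin n (λ k → if i == k then f k else 0ℚ) ≡ f i
sumFin-select (suc n) f fzero =
  trans (cong (f fzero +_) (sumFin-zero n (λ _ → refl))) (ℚₚ.+-identityʳ (f fzero))
sumFin-select (suc n) f (fsuc i) =
  trans (ℚₚ.+-identityˡ _) (sumFin-select n (f ∘ fsuc) i)

sumFin-split : ∀ n (f : Fin n → ℚ) i →
  sumFin n f ≡ f i + sumFin n (λ k → if i == k then 0ℚ else f k)
sumFin-split n f i = begin
  sumFin n f                                  ≡⟨ sumFin-cong n split ⟩
  sumFin n (λ k → selected k + others k)      ≡⟨ sumFin-+ n selected others ⟩
  sumFin n selected + sumFin n others         ≡⟨ cong (_+ sumFin n others) (sumFin-select n f i) ⟩
  f i + sumFin n others                       ∎
  where
  open ≡-Reasoning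
  selected others : Fin n → ℚ
  selected k = if i == k then f k else 0ℚ
  others k = if i == k then 0ℚ else f k
  split : ∀ k → f k ≡ selected k + others k
  split k with i == k
  ... | true = sym (ℚₚ.+-identityʳ (f k))
  ... | false = sym (ℚₚ.+-identityˡ (f k))

sumFin-mono : ∀ n {f g : Fin n → ℚ} → (∀ i → f i ≤ g i) → sumFin n f ≤ sumFin n g
sumFin-mono zero f≤g = ℚₚ.≤-refl
sumFin-mono (suc n) f≤g = ℚₚ.+-mono-≤ (f≤g fzero) (sumFin-mono n (f≤g ∘ fsuc))

sumFin-nonNeg : ∀ n {f : Fin n → ℚ} → (∀ i → 0ℚ ≤ f i) → 0ℚ ≤ sumFin n f
sumFin-nonNeg n {f} 0≤f =
  subst (_≤ sumFin n f) (sumFin-zero n (λ _ → refl)) (sumFin-mono n 0≤f)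

sumFin-mono-≡ : ∀ n {f g : Fin n → ℚ} → (∀ i → f i ≤ g i) → sumFin n f ≡ sumFin n g →
  ∀ i → f i ≡ g i
sumFin-mono-≡ (suc n) {f} {g} f≤g Σf≡Σg = pointwise
  where
  head : f fzero ≡ g fzero
  head with f fzero ℚ.<? g fzero
  ... | yes f₀<g₀ =
    ⊥-elim (ℚₚ.<-irrefl Σf≡Σg (ℚₚ.+-mono-<-≤ f₀<g₀ (sumFin-mono n (f≤g ∘ fsuc))))
  ... | no f₀≮g₀ = ℚₚ.≤-antisym (f≤g fzero) (ℚₚ.≮⇒≥ f₀≮g₀)
  pointwise : ∀ i → f i ≡ g i
  pointwise fzero = head
  pointwise (fsuc i) = sumFin-mono-≡ n (f≤g ∘ fsuc)
    (+-cancelˡ (f fzero) _ _ (trans Σf≡Σg (cong (_+ sumFin n (g ∘ fsuc)) (sym head)))) i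

≤-sumFin : ∀ n {f : Fin n → ℚ} → (∀ i → 0ℚ ≤ f i) → ∀ i → f i ≤ sumFin n f
≤-sumFin (suc n) 0≤f fzero = ≤-+ʳ (sumFin-nonNeg n (0≤f ∘ fsuc))
≤-sumFin (suc n) 0≤f (fsuc i) = ℚₚ.≤-trans (≤-sumFin n (0≤f ∘ fsuc) i) (≤-+ˡ (0≤f fzero))

pair-≤-sumFin : ∀ n {f : Fin n → ℚ} → (∀ i → 0ℚ ≤ f i) →
  ∀ i j → i ≢ j → f i + f j ≤ sumFin n f
pair-≤-sumFin (suc n) 0≤f fzero fzero i≢j = ⊥-elim (i≢j refl)
pair-≤-sumFin (suc n) {f} 0≤f fzero (fsuc j) _ =
  ℚₚ.+-mono-≤ (ℚₚ.≤-refl {f fzero}) (≤-sumFin n (0≤f ∘ fsuc) j)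
pair-≤-sumFin (suc n) {f} 0≤f (fsuc i) fzero _ =
  subst (_≤ sumFin (suc n) f) (ℚₚ.+-comm (f fzero) (f (fsuc i)))
    (ℚₚ.+-mono-≤ (ℚₚ.≤-refl {f fzero}) (≤-sumFin n (0≤f ∘ fsuc) i))
pair-≤-sumFin (suc n) 0≤f (fsuc i) (fsuc j) i≢j =
  ℚₚ.≤-trans (pair-≤-sumFin n (0≤f ∘ fsuc) i j (i≢j ∘ cong fsuc)) (≤-+ˡ (0≤f fzero))

sumFin-pos⇒∃-pos : ∀ n (f : Fin n → ℚ) → 0ℚ < sumFin n f → ∃[ i ] 0ℚ < f i
sumFin-pos⇒∃-pos zero f 0<0 = ⊥-elim (ℚₚ.<-irrefl refl 0<0)
sumFin-pos⇒∃-pos (suc n) f 0<Σf with 0ℚ ℚ.<? f fzero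
... | yes 0<f₀ = fzero , 0<f₀
... | no 0≮f₀ =
  let (i , 0<fᵢ) = sumFin-pos⇒∃-pos n (f ∘ fsuc) (ℚₚ.<-≤-trans 0<Σf tail-dominates)
  in fsuc i , 0<fᵢ
  where
  tail-dominates : sumFin (suc n) f ≤ sumFin n (f ∘ fsuc)
  tail-dominates = subst (sumFin (suc n) f ≤_) (ℚₚ.+-identityˡ _)
    (ℚₚ.+-mono-≤ (ℚₚ.≮⇒≥ 0≮f₀) ℚₚ.≤-refl)

sumFin-bounded : ∀ n {f : Fin n → ℚ} → (∀ i → - 1ℚ ≤ f i × f i ≤ 1ℚ) →
  - ℕ→ℚ n ≤ sumFin n f × sumFin n f ≤ ℕ→ℚ n
sumFin-bounded zero f-bounded = ℚₚ.≤-refl , ℚₚ.≤-refl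
sumFin-bounded (suc n) {f} f-bounded =
  subst (_≤ sumFin (suc n) f) (sym (ℚₚ.neg-distrib-+ 1ℚ (ℕ→ℚ n)))
    (ℚₚ.+-mono-≤ (proj₁ (f-bounded fzero)) (proj₁ rest)) ,
  ℚₚ.+-mono-≤ (proj₂ (f-bounded fzero)) (proj₂ rest)
  where rest = sumFin-bounded n (f-bounded ∘ fsuc)

sumFin-telescope : ∀ n (f : ℕ → ℚ) → sumFin n (λ k → f (toℕ k) - f (suc (toℕ k))) ≡ f 0 - f n
sumFin-telescope zero f = sym (ℚₚ.+-inverseʳ (f 0))
sumFin-telescope (suc n) f = trans (cong (f 0 - f 1 +_) (sumFin-telescope n (f ∘ suc)))
  (solve 3 (λ x y z → (x :- y) :+ (y :- z) := x :- z) refl (f 0) (f 1) (f (suc n)))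

sumFin-telescope′ : ∀ n (f : ℕ → ℚ) → sumFin n (λ k → f (suc (toℕ k)) - f (toℕ k)) ≡ f n - f 0
sumFin-telescope′ zero f = sym (ℚₚ.+-inverseʳ (f 0))
sumFin-telescope′ (suc n) f = trans (cong (f 1 - f 0 +_) (sumFin-telescope′ n (f ∘ suc)))
  (solve 3 (λ x y z → (y :- x) :+ (z :- y) := z :- x) refl (f 0) (f 1) (f (suc n)))

positive-lower-bound : ∀ n (f : Fin n → ℚ) →
  Σ[ μ ∈ ℚ ] 0ℚ < μ × (∀ i → 0ℚ < f i → μ ≤ f i)
positive-lower-bound zero f = 1ℚ , 0<1 , λ ()
positive-lower-bound (suc n) f with positive-lower-bound n (f ∘ fsuc) | 0ℚ ℚ.<? f fzero
... | μ , 0<μ , μ≤ | no 0≮f₀ = μ , 0<μ , λ where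
  fzero 0<f₀ → ⊥-elim (0≮f₀ 0<f₀)
  (fsuc i) 0<fᵢ → μ≤ i 0<fᵢ
... | μ , 0<μ , μ≤ | yes 0<f₀ = f fzero ⊓ μ , ⊓-pos 0<f₀ 0<μ , λ where
  fzero _ → ℚₚ.p⊓q≤p (f fzero) μ
  (fsuc i) 0<fᵢ → ℚₚ.≤-trans (ℚₚ.p⊓q≤q (f fzero) μ) (μ≤ i 0<fᵢ)

another-fractional : ∀ n (f : Fin n → ℚ) → (∀ i → 0ℚ ≤ f i) → sumFin n f ≡ 1ℚ →
  ∀ i → Fractional (f i) → Σ[ j ∈ Fin n ] j ≢ i × Fractional (f j)
another-fractional n f 0≤f Σf≡1 i (0<fᵢ , fᵢ<1) with sumFin-pos⇒∃-pos n others 0<Σothers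
  where
  others : Fin n → ℚ
  others k = if i == k then 0ℚ else f k
  0<Σothers : 0ℚ < sumFin n others
  0<Σothers with 0ℚ ℚ.<? sumFin n others
  ... | yes 0<Σ = 0<Σ
  ... | no 0≮Σ = ⊥-elim (ℚₚ.<-irrefl refl (ℚₚ.<-≤-trans fᵢ<1 (begin
    1ℚ                        ≡⟨ trans (sym Σf≡1) (sumFin-split n f i) ⟩
    f i + sumFin n others     ≤⟨ ℚₚ.+-mono-≤ (ℚₚ.≤-refl {f i}) (ℚₚ.≮⇒≥ 0≮Σ) ⟩
    f i + 0ℚ                  ≡⟨ ℚₚ.+-identityʳ (f i) ⟩
    f i                       ∎)))
    where open ℚₚ.≤-Reasoning
... | j , 0<othersⱼ with i == j in i==j
...   | true = ⊥-elim (ℚₚ.<-irrefl refl 0<othersⱼ)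
...   | false = j , j≢i , 0<othersⱼ , fⱼ<1
  where
  j≢i : j ≢ i
  j≢i refl with trans (sym (==-refl i)) i==j
  ... | ()
  fⱼ<1 : f j < 1ℚ
  fⱼ<1 = begin-strict
    f j         ≡⟨ sym (ℚₚ.+-identityˡ (f j)) ⟩
    0ℚ + f j    <⟨ ℚₚ.+-monoˡ-< (f j) 0<fᵢ ⟩
    f i + f j   ≤⟨ pair-≤-sumFin n 0≤f i j (j≢i ∘ sym) ⟩
    sumFin n f  ≡⟨ Σf≡1 ⟩
    1ℚ          ∎
    where open ℚₚ.≤-Reasoning

rowSum : ∀ {a b} → (Fin a → Fin b → ℚ) → Fin a → ℚ
rowSum {b = b} X s = sumFin b (X s)

colSum : ∀ {a b} → (Fin a → Fin b → ℚ) → Fin b → ℚ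
colSum {a = a} X t = sumFin a (λ s → X s t)

module Perturbation {a b : ℕ} (X : Fin a → Fin b → ℚ) where

  record Direction (L : ℕ) (D : Fin a → Fin b → ℚ) : Set where
    field
      support            : ∀ s t → ¬ Fractional (X s t) → D s t ≡ 0ℚ
      bounded            : ∀ s t → - ℕ→ℚ L ≤ D s t × D s t ≤ ℕ→ℚ L
      row-balanced       : ∀ s → rowSum D s ≡ 0ℚ
      tight-col-balanced : ∀ t → colSum X t ≡ 1ℚ → colSum D t ≡ 0ℚ
      col-bounded        : ∀ t → - 1ℚ ≤ colSum D t × colSum D t ≤ 1ℚ

  record Admissible (E : Fin a → Fin b → ℚ) : Set where
    field
      nonNeg       : ∀ s t → 0ℚ ≤ X s t + E s t
      row-balanced : ∀ s → rowSum E s ≡ 0ℚ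
      col≤1        : ∀ t → colSum (λ s t → X s t + E s t) t ≤ 1ℚ
      support      : ∀ s t → X s t ≡ 0ℚ → E s t ≡ 0ℚ

  neg-direction : ∀ {L D} → Direction L D → Direction L (λ s t → - D s t)
  neg-direction {L} {D} dir = record
    { support = λ s t ¬frac → cong -_ (support s t ¬frac)
    ; bounded = λ s t → let (lo , hi) = bounded s t in
        ℚₚ.neg-antimono-≤ hi , subst (- D s t ≤_) (neg-involutive (ℕ→ℚ L)) (ℚₚ.neg-antimono-≤ lo)
    ; row-balanced = λ s → trans (sumFin-neg b (D s)) (cong -_ (row-balanced s))
    ; tight-col-balanced = λ t tight → trans (sumFin-neg a _) (cong -_ (tight-col-balanced t tight))
    ; col-bounded = λ t → let (lo , hi) = col-bounded t in
        subst (- 1ℚ ≤_) (sym (sumFin-neg a _)) (ℚₚ.neg-antimono-≤ hi) ,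
        subst₂ _≤_ (sym (sumFin-neg a _)) (neg-involutive 1ℚ) (ℚₚ.neg-antimono-≤ lo)
    }
    where open Direction dir

  NonzeroDirection : Set
  NonzeroDirection = Σ[ L ∈ ℕ ] Σ[ D ∈ (Fin a → Fin b → ℚ) ] Direction L D ×
                     Σ[ s ∈ Fin a ] Σ[ t ∈ Fin b ] D s t ≢ 0ℚ

  slack : Fin b → ℚ
  slack t = 1ℚ - colSum X t

  row-bound : Fin a → ℚ
  row-bound s = proj₁ (positive-lower-bound b (X s))

  entry-bound slack-bound μ : ℚ
  entry-bound = proj₁ (positive-lower-bound a row-bound)
  slack-bound = proj₁ (positive-lower-bound b slack)
  μ = entry-bound ⊓ slack-bound

  0<μ : 0ℚ < μ
  0<μ = ⊓-pos (proj₁ (proj₂ (positive-lower-bound a row-bound)))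
              (proj₁ (proj₂ (positive-lower-bound b slack)))

  μ≤entry : ∀ s t → 0ℚ < X s t → μ ≤ X s t
  μ≤entry s t 0<X = begin
    μ            ≤⟨ ℚₚ.p⊓q≤p entry-bound slack-bound ⟩
    entry-bound  ≤⟨ proj₂ (proj₂ (positive-lower-bound a row-bound)) s
                     (proj₁ (proj₂ (positive-lower-bound b (X s)))) ⟩
    row-bound s  ≤⟨ proj₂ (proj₂ (positive-lower-bound b (X s))) t 0<X ⟩
    X s t        ∎
    where open ℚₚ.≤-Reasoning

  μ≤slack : ∀ t → colSum X t < 1ℚ → μ ≤ slack t
  μ≤slack t col<1 = ℚₚ.≤-trans (ℚₚ.p⊓q≤q entry-bound slack-bound)
    (proj₂ (proj₂ (positive-lower-bound b slack)) t (p<q⇒0<q-p col<1))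

  -- ε = μ / (1 + L) gives ε L ≤ μ and ε ≤ μ, so ε D can neither exceed a positive entry of X
  -- nor the slack of a column that is not full.
  module Step (L : ℕ) where

    1+L : ℚ
    1+L = ℕ→ℚ (suc L)

    0<1+L : 0ℚ < 1+L
    0<1+L = ℚₚ.<-≤-trans 0<1 (≤-+ʳ (ℕ→ℚ-nonNeg L))

    instance
      1+L≢0 : ℚ.NonZero 1+L
      1+L≢0 = ℚₚ.pos⇒nonZero 1+L {{ℚ.positive 0<1+L}}

    ε : ℚ
    ε = μ * 1/ 1+L

    0<ε : 0ℚ < ε
    0<ε = ℚₚ.positive⁻¹ ε {{ℚₚ.pos*pos⇒pos μ {{ℚ.positive 0<μ}} (1/ 1+L)
                                {{ℚₚ.1/pos⇒pos 1+L {{ℚ.positive 0<1+L}}}}}}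

    ε*1+L≡μ : ε * 1+L ≡ μ
    ε*1+L≡μ = trans (ℚₚ.*-assoc μ (1/ 1+L) 1+L)
      (trans (cong (μ *_) (ℚₚ.*-inverseˡ 1+L)) (ℚₚ.*-identityʳ μ))

    ε*L≤μ : ε * ℕ→ℚ L ≤ μ
    ε*L≤μ = subst (ε * ℕ→ℚ L ≤_) ε*1+L≡μ (*-monoˡ-≤-nonNeg (ℚₚ.<⇒≤ 0<ε) (≤-+ˡ 0≤1))

    ε≤μ : ε ≤ μ
    ε≤μ = subst₂ _≤_ (ℚₚ.*-identityʳ ε) ε*1+L≡μ
      (*-monoˡ-≤-nonNeg (ℚₚ.<⇒≤ 0<ε) (≤-+ʳ (ℕ→ℚ-nonNeg L)))

    direction-admissible : (∀ s t → 0ℚ ≤ X s t) → (∀ t → colSum X t ≤ 1ℚ) →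
      ∀ {D} → Direction L D → Admissible (λ s t → ε * D s t)
    direction-admissible X≥0 colX≤1 {D} dir = record
      { nonNeg = nonNeg
      ; row-balanced = λ s →
          trans (sumFin-*ˡ b ε (D s)) (trans (cong (ε *_) (row-balanced s)) (ℚₚ.*-zeroʳ ε))
      ; col≤1 = col≤1
      ; support = λ s t X≡0 → εD≡0 s t (λ (0<X , _) → ℚₚ.<-irrefl (sym X≡0) 0<X)
      }
      where
      open Direction dir
      open ℚₚ.≤-Reasoning

      εD≡0 : ∀ s t → ¬ Fractional (X s t) → ε * D s t ≡ 0ℚ
      εD≡0 s t ¬frac = trans (cong (ε *_) (support s t ¬frac)) (ℚₚ.*-zeroʳ ε)

      nonNeg : ∀ s t → 0ℚ ≤ X s t + ε * D s t
      nonNeg s t with 0ℚ ℚ.<? X s t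
      ... | no 0≮X = subst (0ℚ ≤_)
              (sym (trans (cong (X s t +_) (εD≡0 s t (λ (0<X , _) → 0≮X 0<X))) (ℚₚ.+-identityʳ (X s t))))
              (X≥0 s t)
      ... | yes 0<X = begin
        0ℚ                 ≡⟨ sym (ℚₚ.+-inverseʳ (X s t)) ⟩
        X s t - X s t      ≤⟨ ℚₚ.+-monoʳ-≤ (X s t) -X≤εD ⟩
        X s t + ε * D s t  ∎
        where
        -X≤εD : - X s t ≤ ε * D s t
        -X≤εD = begin
          - X s t          ≤⟨ ℚₚ.neg-antimono-≤ (μ≤entry s t 0<X) ⟩
          - μ              ≤⟨ ℚₚ.neg-antimono-≤ ε*L≤μ ⟩
          - (ε * ℕ→ℚ L)    ≡⟨ ℚₚ.neg-distribʳ-* ε (ℕ→ℚ L) ⟩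
          ε * - ℕ→ℚ L      ≤⟨ *-monoˡ-≤-nonNeg (ℚₚ.<⇒≤ 0<ε) (proj₁ (bounded s t)) ⟩
          ε * D s t        ∎

      col≤1 : ∀ t → colSum (λ s t → X s t + ε * D s t) t ≤ 1ℚ
      col≤1 t = begin
        colSum (λ s t → X s t + ε * D s t) t
          ≡⟨ trans (sumFin-+ a _ _) (cong (colSum X t +_) (sumFin-*ˡ a ε _)) ⟩
        colSum X t + ε * colSum D t           ≤⟨ shifted ⟩
        1ℚ                                    ∎
        where
        shifted : colSum X t + ε * colSum D t ≤ 1ℚ
        shifted with colSum X t ℚₚ.≟ 1ℚ
        ... | yes tight = begin
          colSum X t + ε * colSum D t  ≡⟨ cong (λ c → colSum X t + ε * c) (tight-col-balanced t tight) ⟩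
          colSum X t + ε * 0ℚ          ≡⟨ cong (colSum X t +_) (ℚₚ.*-zeroʳ ε) ⟩
          colSum X t + 0ℚ              ≡⟨ ℚₚ.+-identityʳ (colSum X t) ⟩
          colSum X t                   ≤⟨ colX≤1 t ⟩
          1ℚ                           ∎
        ... | no ¬tight = begin
          colSum X t + ε * colSum D t
            ≤⟨ ℚₚ.+-monoʳ-≤ (colSum X t) (*-monoˡ-≤-nonNeg (ℚₚ.<⇒≤ 0<ε) (proj₂ (col-bounded t))) ⟩
          colSum X t + ε * 1ℚ
            ≡⟨ cong (colSum X t +_) (ℚₚ.*-identityʳ ε) ⟩
          colSum X t + ε
            ≤⟨ ℚₚ.+-monoʳ-≤ (colSum X t) (ℚₚ.≤-trans ε≤μ (μ≤slack t (≤∧≢⇒< (colX≤1 t) ¬tight))) ⟩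
          colSum X t + slack t
            ≡⟨ solve 1 (λ c → c :+ (con 1ℚ :- c) := con 1ℚ) refl (colSum X t) ⟩
          1ℚ ∎


module AlternatingWalk {a b : ℕ} (X : Fin a → Fin b → ℚ) (X≥0 : ∀ s t → 0ℚ ≤ X s t)
  (rowX≡1 : ∀ s → rowSum X s ≡ 1ℚ) (colX≤1 : ∀ t → colSum X t ≤ 1ℚ) where

  open Perturbation X using (Direction; NonzeroDirection)

  Vertex : Set
  Vertex = Fin a ⊎ Fin b

  _≟ᵥ_ : (u v : Vertex) → Dec (u ≡ v)
  _≟ᵥ_ = ⊎ₚ.≡-dec Fₚ._≟_ Fₚ._≟_

  Unsaturated : Vertex → Set
  Unsaturated (inj₁ _) = ⊥
  Unsaturated (inj₂ t) = colSum X t ≢ 1ℚ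

  unsaturated? : ∀ v → Dec (Unsaturated v)
  unsaturated? (inj₁ _) = no (λ ())
  unsaturated? (inj₂ t) = ¬? (colSum X t ℚₚ.≟ 1ℚ)

  data Arc : Set where
    row→col : (s : Fin a) (t : Fin b) → Fractional (X s t) → Arc
    col→row : (t : Fin b) (s : Fin a) → Fractional (X s t) → Arc

  row : Arc → Fin a
  row (row→col s _ _) = s
  row (col→row _ s _) = s

  column : Arc → Fin b
  column (row→col _ t _) = t
  column (col→row t _ _) = t

  arc-fractional : ∀ α → Fractional (X (row α) (column α))
  arc-fractional (row→col _ _ frac) = frac
  arc-fractional (col→row _ _ frac) = frac

  source target : Arc → Vertex
  source (row→col s _ _) = inj₁ s
  source (col→row t _ _) = inj₂ t
  target (row→col _ t _) = inj₂ t
  target (col→row _ s _) = inj₁ s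

  leave-row : ∀ s t → Fractional (X s t) → Σ[ t′ ∈ Fin b ] t′ ≢ t × Fractional (X s t′)
  leave-row s = another-fractional b (X s) (X≥0 s) (rowX≡1 s)

  leave-column : ∀ s t → Fractional (X s t) →
    Σ[ s′ ∈ Fin a ] (colSum X t ≡ 1ℚ → s′ ≢ s) × Fractional (X s′ t)
  leave-column s t frac with colSum X t ℚₚ.≟ 1ℚ
  ... | no ¬tight = s , (λ tight → ⊥-elim (¬tight tight)) , frac
  ... | yes tight =
    let (s′ , s′≢s , frac′) = another-fractional a (λ s → X s t) (λ s → X≥0 s t) tight s frac
    in s′ , (λ _ → s′≢s) , frac′

  -- An unsaturated column may send the walk back along the arc it came from; the walk stops there anyway.
  next : Arc → Arc
  next (row→col s t frac) = col→row t (proj₁ (leave-column s t frac)) (proj₂ (proj₂ (leave-column s t frac)))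
  next (col→row t s frac) = row→col s (proj₁ (leave-row s t frac)) (proj₂ (proj₂ (leave-row s t frac)))

  walk : Arc → ℕ → Arc
  walk α zero = α
  walk α (suc k) = next (walk α k)

  source-next : ∀ α → source (next α) ≡ target α
  source-next (row→col _ _ _) = refl
  source-next (col→row _ _ _) = refl

  next-alternates : ∀ α → source (next α) ≢ source α
  next-alternates (row→col _ _ _) ()
  next-alternates (col→row _ _ _) ()

  next-no-backtrack : ∀ α → ¬ Unsaturated (target α) → target (next α) ≢ source α
  next-no-backtrack (row→col s t frac) saturated same =
    proj₁ (proj₂ (leave-column s t frac)) (decidable-stable (colSum X t ℚₚ.≟ 1ℚ) saturated)
      (⊎ₚ.inj₁-injective same)
  next-no-backtrack (col→row t s frac) _ same =
    proj₁ (proj₂ (leave-row s t frac)) (⊎ₚ.inj₂-injective same)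

  same-edge⇒same-source : ∀ α β → row α ≡ row β → column α ≡ column β →
    source α ≡ source β ⊎ source α ≡ target β
  same-edge⇒same-source (row→col _ _ _) (row→col _ _ _) r _ = inj₁ (cong inj₁ r)
  same-edge⇒same-source (row→col _ _ _) (col→row _ _ _) r _ = inj₂ (cong inj₁ r)
  same-edge⇒same-source (col→row _ _ _) (row→col _ _ _) _ c = inj₂ (cong inj₂ c)
  same-edge⇒same-source (col→row _ _ _) (col→row _ _ _) _ c = inj₁ (cong inj₂ c)

  same-edge⇒same-target : ∀ α β → row α ≡ row β → column α ≡ column β →
    target α ≡ source β ⊎ target α ≡ target β
  same-edge⇒same-target (row→col _ _ _) (row→col _ _ _) _ c = inj₂ (cong inj₂ c)
  same-edge⇒same-target (row→col _ _ _) (col→row _ _ _) _ c = inj₁ (cong inj₂ c)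
  same-edge⇒same-target (col→row _ _ _) (row→col _ _ _) r _ = inj₁ (cong inj₁ r)
  same-edge⇒same-target (col→row _ _ _) (col→row _ _ _) r _ = inj₂ (cong inj₁ r)

  sign : Arc → ℚ
  sign (row→col _ _ _) = 1ℚ
  sign (col→row _ _ _) = - 1ℚ

  contribution : Arc → Fin a → Fin b → ℚ
  contribution α s t = if row α == s then (if column α == t then sign α else 0ℚ) else 0ℚ

  contribution-on-edge : ∀ α → contribution α (row α) (column α) ≡ sign α
  contribution-on-edge α rewrite ==-refl (row α) | ==-refl (column α) = refl

  contribution-off-edge : ∀ α s t → (row α ≡ s → column α ≡ t → ⊥) → contribution α s t ≡ 0ℚ
  contribution-off-edge α s t off with row α == s in r | column α == t in c
  ... | true | true = ⊥-elim (off (==⇒≡ r) (==⇒≡ c))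
  ... | true | false = refl
  ... | false | _ = refl

  contribution-bounded : ∀ α s t → - 1ℚ ≤ contribution α s t × contribution α s t ≤ 1ℚ
  contribution-bounded (row→col s′ t′ _) s t with s′ == s | t′ == t
  ... | true | true = ℚₚ.≤ᵇ⇒≤ tt , ℚₚ.≤-refl
  ... | true | false = ℚₚ.≤ᵇ⇒≤ tt , ℚₚ.≤ᵇ⇒≤ tt
  ... | false | _ = ℚₚ.≤ᵇ⇒≤ tt , ℚₚ.≤ᵇ⇒≤ tt
  contribution-bounded (col→row t′ s′ _) s t with s′ == s | t′ == t
  ... | true | true = ℚₚ.≤-refl , ℚₚ.≤ᵇ⇒≤ tt
  ... | true | false = ℚₚ.≤ᵇ⇒≤ tt , ℚₚ.≤ᵇ⇒≤ tt
  ... | false | _ = ℚₚ.≤ᵇ⇒≤ tt , ℚₚ.≤ᵇ⇒≤ tt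

  -- Line sums of a contribution are differences of these indicators, so along a walk they telescope.
  at-row : Fin a → Arc → ℚ
  at-row s (row→col s′ _ _) = if s′ == s then 1ℚ else 0ℚ
  at-row s (col→row _ _ _) = 0ℚ

  at-column : Fin b → Arc → ℚ
  at-column t (row→col _ _ _) = 0ℚ
  at-column t (col→row t′ _ _) = if t′ == t then 1ℚ else 0ℚ

  rowSum-contribution : ∀ α s → rowSum (contribution α) s ≡ at-row s α - at-row s (next α)
  rowSum-contribution α s = trans (sumFin-if b (row α == s) _)
    (trans (cong (λ q → if row α == s then q else 0ℚ) (sumFin-select b (λ _ → sign α) (column α)))
           (signed-indicator α))
    where
    signed-indicator : ∀ α → (if row α == s then sign α else 0ℚ) ≡ at-row s α - at-row s (next α)
    signed-indicator (row→col s′ _ _) with s′ == s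
    ... | true = refl
    ... | false = refl
    signed-indicator (col→row _ s′ _) with s′ == s
    ... | true = refl
    ... | false = refl

  colSum-contribution : ∀ α t → colSum (contribution α) t ≡ at-column t (next α) - at-column t α
  colSum-contribution α t = trans (sumFin-select a (λ _ → if column α == t then sign α else 0ℚ) (row α))
    (signed-indicator α)
    where
    signed-indicator : ∀ α → (if column α == t then sign α else 0ℚ) ≡ at-column t (next α) - at-column t α
    signed-indicator (row→col _ t′ _) with t′ == t
    ... | true = refl
    ... | false = refl
    signed-indicator (col→row t′ _ _) with t′ == t
    ... | true = refl
    ... | false = refl

  at-row-source : ∀ s α β → source α ≡ source β → at-row s α ≡ at-row s β
  at-row-source s (row→col _ _ _) (row→col _ _ _) same =
    cong (λ s′ → if s′ == s then 1ℚ else 0ℚ) (⊎ₚ.inj₁-injective same)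
  at-row-source s (col→row _ _ _) (col→row _ _ _) _ = refl

  at-column-source : ∀ t α β → source α ≡ source β → at-column t α ≡ at-column t β
  at-column-source t (row→col _ _ _) (row→col _ _ _) _ = refl
  at-column-source t (col→row _ _ _) (col→row _ _ _) same =
    cong (λ t′ → if t′ == t then 1ℚ else 0ℚ) (⊎ₚ.inj₂-injective same)

  at-row-unsaturated : ∀ s α → Unsaturated (source α) → at-row s α ≡ 0ℚ
  at-row-unsaturated s (col→row _ _ _) _ = refl

  at-column-unsaturated : ∀ t α → Unsaturated (source α) → colSum X t ≡ 1ℚ → at-column t α ≡ 0ℚ
  at-column-unsaturated t (col→row t′ _ _) unsat tight with t′ == t in t′==t
  ... | true = ⊥-elim (unsat (subst (λ t → colSum X t ≡ 1ℚ) (sym (==⇒≡ t′==t)) tight))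
  ... | false = refl

  at-column-bit : ∀ t α → at-column t α ≡ 0ℚ ⊎ at-column t α ≡ 1ℚ
  at-column-bit t (row→col _ _ _) = inj₁ refl
  at-column-bit t (col→row t′ _ _) with t′ == t
  ... | true = inj₂ refl
  ... | false = inj₁ refl

  module Segment (α₀ : Arc) (i l j : ℕ) (j≡1+l+i : suc l ℕ.+ i ≡ j)
    (distinct : ∀ p q → i ℕ.≤ p → p ℕ.< q → q ℕ.< j → source (walk α₀ p) ≢ source (walk α₀ q))
    (saturated : ∀ k → i ℕ.< k → k ℕ.< j → ¬ Unsaturated (source (walk α₀ k)))
    (closed-or-open : source (walk α₀ i) ≡ source (walk α₀ j)
                    ⊎ Unsaturated (source (walk α₀ i)) × Unsaturated (source (walk α₀ j))) where

    w : ℕ → Arc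
    w = walk α₀

    D : Fin a → Fin b → ℚ
    D s t = sumFin (suc l) (λ k → contribution (w (toℕ k ℕ.+ i)) s t)

    last≡j : w (suc l ℕ.+ i) ≡ w j
    last≡j = cong w j≡1+l+i

    rowSum-D : ∀ s → rowSum D s ≡ at-row s (w i) - at-row s (w j)
    rowSum-D s = begin
      rowSum D s
        ≡⟨ sumFin-comm b (suc l) (λ t k → contribution (w (toℕ k ℕ.+ i)) s t) ⟩
      sumFin (suc l) (λ k → rowSum (contribution (w (toℕ k ℕ.+ i))) s)
        ≡⟨ sumFin-cong (suc l) (λ k → rowSum-contribution (w (toℕ k ℕ.+ i)) s) ⟩
      sumFin (suc l) (λ k → at-row s (w (toℕ k ℕ.+ i)) - at-row s (w (suc (toℕ k) ℕ.+ i)))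
        ≡⟨ sumFin-telescope (suc l) (λ k → at-row s (w (k ℕ.+ i))) ⟩
      at-row s (w i) - at-row s (w (suc l ℕ.+ i))
        ≡⟨ cong (λ α → at-row s (w i) - at-row s α) last≡j ⟩
      at-row s (w i) - at-row s (w j) ∎
      where open ≡-Reasoning

    colSum-D : ∀ t → colSum D t ≡ at-column t (w j) - at-column t (w i)
    colSum-D t = begin
      colSum D t
        ≡⟨ sumFin-comm a (suc l) (λ s k → contribution (w (toℕ k ℕ.+ i)) s t) ⟩
      sumFin (suc l) (λ k → colSum (contribution (w (toℕ k ℕ.+ i))) t)
        ≡⟨ sumFin-cong (suc l) (λ k → colSum-contribution (w (toℕ k ℕ.+ i)) t) ⟩
      sumFin (suc l) (λ k → at-column t (w (suc (toℕ k) ℕ.+ i)) - at-column t (w (toℕ k ℕ.+ i)))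
        ≡⟨ sumFin-telescope′ (suc l) (λ k → at-column t (w (k ℕ.+ i))) ⟩
      at-column t (w (suc l ℕ.+ i)) - at-column t (w i)
        ≡⟨ cong (λ α → at-column t α - at-column t (w i)) last≡j ⟩
      at-column t (w j) - at-column t (w i) ∎
      where open ≡-Reasoning

    direction : Direction (suc l) D
    direction = record
      { support = λ s t ¬frac → sumFin-zero (suc l) (λ k →
          contribution-off-edge (w (toℕ k ℕ.+ i)) s t
            (λ { refl refl → ¬frac (arc-fractional (w (toℕ k ℕ.+ i))) }))
      ; bounded = λ s t → sumFin-bounded (suc l) (λ k → contribution-bounded (w (toℕ k ℕ.+ i)) s t)
      ; row-balanced = λ s → trans (rowSum-D s) (row-ends s closed-or-open)
      ; tight-col-balanced = λ t tight → trans (colSum-D t) (column-ends t tight closed-or-open)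
      ; col-bounded = λ t → subst (λ c → - 1ℚ ≤ c × c ≤ 1ℚ) (sym (colSum-D t))
          (bit-difference-bounded (at-column-bit t (w j)) (at-column-bit t (w i)))
      }
      where
      Ends : Set
      Ends = source (w i) ≡ source (w j) ⊎ Unsaturated (source (w i)) × Unsaturated (source (w j))
      row-ends : ∀ s → Ends → at-row s (w i) - at-row s (w j) ≡ 0ℚ
      row-ends s (inj₁ closed) = trans (cong (λ z → at-row s (w i) - z) (sym (at-row-source s _ _ closed)))
        (ℚₚ.+-inverseʳ (at-row s (w i)))
      row-ends s (inj₂ (open₀ , open₁)) =
        cong₂ _-_ (at-row-unsaturated s _ open₀) (at-row-unsaturated s _ open₁)
      column-ends : ∀ t → colSum X t ≡ 1ℚ → Ends → at-column t (w j) - at-column t (w i) ≡ 0ℚ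
      column-ends t tight (inj₁ closed) =
        trans (cong (_- at-column t (w i)) (sym (at-column-source t _ _ closed)))
              (ℚₚ.+-inverseʳ (at-column t (w i)))
      column-ends t tight (inj₂ (open₀ , open₁)) =
        cong₂ _-_ (at-column-unsaturated t _ open₁ tight) (at-column-unsaturated t _ open₀ tight)

    -- A later arc on the edge of w i would revisit one of its endpoints, or turn straight back.
    edge-used-once : ∀ k → i ℕ.< k → k ℕ.< j →
      row (w k) ≡ row (w i) → column (w k) ≡ column (w i) → ⊥
    edge-used-once k i<k k<j r c with k ℕ.≟ suc i
    ... | yes refl with same-edge⇒same-target (w (suc i)) (w i) r c
    ...   | inj₁ back = next-no-backtrack (w i)
              (subst (λ v → ¬ Unsaturated v) (source-next (w i)) (saturated (suc i) ℕₚ.≤-refl k<j)) back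
    ...   | inj₂ stay = next-alternates (w (suc i))
              (trans (source-next (w (suc i))) (trans stay (sym (source-next (w i)))))
    edge-used-once k i<k k<j r c | no k≢1+i with same-edge⇒same-source (w k) (w i) r c
    ...   | inj₁ same = distinct i k ℕₚ.≤-refl i<k k<j (sym same)
    ...   | inj₂ same = distinct (suc i) k (ℕₚ.n≤1+n i) (ℕₚ.≤∧≢⇒< i<k (k≢1+i ∘ sym)) k<j
              (trans (source-next (w i)) (sym same))

    D-on-first-edge : D (row (w i)) (column (w i)) ≡ sign (w i)
    D-on-first-edge = begin
      D (row (w i)) (column (w i))
        ≡⟨ cong₂ _+_ (contribution-on-edge (w i)) (sumFin-zero l (λ k →
             contribution-off-edge (w (suc (toℕ k) ℕ.+ i)) _ _
               (edge-used-once (suc (toℕ k) ℕ.+ i) (ℕ.s≤s (ℕₚ.m≤n+m i (toℕ k)))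
                 (subst (suc (toℕ k) ℕ.+ i ℕ.<_) j≡1+l+i (ℕ.s≤s (ℕₚ.+-monoˡ-< i (Fₚ.toℕ<n k))))))) ⟩
      sign (w i) + 0ℚ
        ≡⟨ ℚₚ.+-identityʳ (sign (w i)) ⟩
      sign (w i) ∎
      where open ≡-Reasoning

    nonzero-direction : NonzeroDirection
    nonzero-direction = suc l , D , direction , row (w i) , column (w i) ,
      λ D≡0 → sign≢0 (w i) (trans (sym D-on-first-edge) D≡0)
      where
      sign≢0 : ∀ α → sign α ≢ 0ℚ
      sign≢0 (row→col _ _ _) ()
      sign≢0 (col→row _ _ _) ()

  module Search (α₀ : Arc) where

    v : ℕ → Vertex
    v k = source (walk α₀ k)

    Stop : ℕ → Set
    Stop j = (Σ[ p ∈ Fin j ] v (toℕ p) ≡ v j) ⊎ (1 ℕ.≤ j × Unsaturated (v j))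

    stop? : ∀ j → Dec (Stop j)
    stop? j = Fₚ.any? (λ p → v (toℕ p) ≟ᵥ v j) ⊎-dec ((1 ℕ.≤? j) ×-dec unsaturated? (v j))

    eventually-stops : Σ ℕ Stop
    eventually-stops with Fₚ.pigeonhole (ℕₚ.n<1+n (a ℕ.+ b)) (λ k → F.join a b (v (toℕ k)))
    ... | p , q , p<q , same =
      toℕ q , inj₁ (F.fromℕ< p<q , trans (cong v (Fₚ.toℕ-fromℕ< p<q)) (join-injective same))
      where
      join-injective : ∀ {u u′ : Vertex} → F.join a b u ≡ F.join a b u′ → u ≡ u′
      join-injective {u} {u′} e =
        trans (sym (Fₚ.splitAt-join a b u)) (trans (cong (F.splitAt a) e) (Fₚ.splitAt-join a b u′))

    Unstopped : ℕ → Set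
    Unstopped j = ∀ k → k ℕ.< j → ¬ Stop k

    distinct-before : ∀ {j} → Unstopped j → ∀ p q → p ℕ.< q → q ℕ.< j → v p ≢ v q
    distinct-before unstopped p q p<q q<j same =
      unstopped q q<j (inj₁ (F.fromℕ< p<q , trans (cong v (Fₚ.toℕ-fromℕ< p<q)) same))

    saturated-before : ∀ {j} → Unstopped j → ∀ k → 1 ℕ.≤ k → k ℕ.< j → ¬ Unsaturated (v k)
    saturated-before unstopped k 1≤k k<j unsat = unstopped k k<j (inj₂ (1≤k , unsat))

    explore : NonzeroDirection ⊎ (Σ[ j ∈ ℕ ] 1 ℕ.≤ j × Unsaturated (v j) × Unstopped j)
    explore with minimal-witness stop? (proj₂ eventually-stops)
    ... | j , inj₂ (1≤j , unsat) , unstopped = inj₂ (j , 1≤j , unsat , unstopped)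
    ... | j , inj₁ (p , repeat) , unstopped =
      inj₁ (Segment.nonzero-direction α₀ (toℕ p) (j ∸ suc (toℕ p)) j
            (trans (sym (ℕₚ.+-suc (j ∸ suc (toℕ p)) (toℕ p))) (ℕₚ.m∸n+n≡m (Fₚ.toℕ<n p)))
            (λ p q _ → distinct-before unstopped p q)
            (λ k p<k → saturated-before unstopped k (ℕₚ.≤-trans (ℕ.s≤s ℕ.z≤n) p<k))
            (inj₁ repeat))

  -- Followed from an unsaturated column, the walk closes a cycle or reaches another unsaturated column.
  direction-from-unsaturated : ∀ α₀ → Unsaturated (source α₀) → NonzeroDirection
  direction-from-unsaturated α₀ unsat₀ with Search.explore α₀
  ... | inj₁ found = found
  ... | inj₂ (suc l , _ , unsat , unstopped) =
    Segment.nonzero-direction α₀ 0 l (suc l) (ℕₚ.+-identityʳ (suc l))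
          (λ p q _ → Search.distinct-before α₀ unstopped p q)
          (λ k 0<k → Search.saturated-before α₀ unstopped k 0<k)
          (inj₂ (unsat₀ , unsat))

  -- A walk from a row that reaches an unsaturated column is restarted there, to find a path between two.
  direction-through : ∀ s t → Fractional (X s t) → NonzeroDirection
  direction-through s t frac with Search.explore (row→col s t frac)
  ... | inj₁ found = found
  ... | inj₂ (j , _ , unsat , _) = direction-from-unsaturated (walk (row→col s t frac) j) unsat

inWindow-intro : ∀ d i k → i ℕ.≤ k → k ℕ.< i ℕ.+ d → inWindow d i k ≡ true
inWindow-intro d i k i≤k k<i+d = cong₂ _∧_ (dec-true (i ℕ.≤? k) i≤k) (dec-true (k ℕ.<? i ℕ.+ d) k<i+d)

inWindow-elim : ∀ d i k → inWindow d i k ≡ true → i ℕ.≤ k × k ℕ.< i ℕ.+ d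
inWindow-elim d i k = both (i ℕ.≤? k) (k ℕ.<? i ℕ.+ d)
  where
  both : ∀ {P Q : Set} (p? : Dec P) (q? : Dec Q) → (does p? ∧ does q?) ≡ true → P × Q
  both (yes p) (yes q) _ = p , q
  both (yes _) (no _) ()
  both (no _) _ ()

inWindow-before : ∀ d i k → ¬ i ℕ.≤ k → inWindow d i k ≡ false
inWindow-before d i k i≰k rewrite dec-false (i ℕ.≤? k) i≰k = refl

inWindow-after : ∀ d i k → ¬ k ℕ.< i ℕ.+ d → inWindow d i k ≡ false
inWindow-after d i k k≮i+d rewrite dec-false (k ℕ.<? i ℕ.+ d) k≮i+d = 𝔹ₚ.∧-zeroʳ (does (i ℕ.≤? k))

inWindow-suc : ∀ d i k → inWindow d (suc i) (suc k) ≡ inWindow d i k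
inWindow-suc d zero k = refl
inWindow-suc d (suc i) k = refl

if-≤ : ∀ (c : Bool) {q} → 0ℚ ≤ q → (if c then q else 0ℚ) ≤ q
if-≤ true 0≤q = ℚₚ.≤-refl
if-≤ false 0≤q = 0≤q

if-mono : ∀ (c c′ : Bool) {q} → 0ℚ ≤ q → (c ≡ true → c′ ≡ true) →
  (if c then q else 0ℚ) ≤ (if c′ then q else 0ℚ)
if-mono true c′ 0≤q c⇒c′ rewrite c⇒c′ refl = ℚₚ.≤-refl
if-mono false true 0≤q _ = 0≤q
if-mono false false 0≤q _ = ℚₚ.≤-refl

windowSum : ∀ {n} (d : ℕ) → (Fin n → ℚ) → ℕ → ℚ
windowSum {n} d f i = sumFin n (λ s → if inWindow d i (toℕ s) then f s else 0ℚ)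

windowSum-whole : ∀ {n} d (f : Fin n → ℚ) → n ℕ.≤ d → windowSum d f 0 ≡ sumFin n f
windowSum-whole {n} d f n≤d = sumFin-cong n (λ s → cong (λ c → if c then f s else 0ℚ)
  (inWindow-intro d 0 (toℕ s) ℕ.z≤n (ℕₚ.<-≤-trans (Fₚ.toℕ<n s) n≤d)))

windowSum-≤-sumFin : ∀ {n} d (f : Fin n → ℚ) i → (∀ s → 0ℚ ≤ f s) → windowSum d f i ≤ sumFin n f
windowSum-≤-sumFin {n} d f i 0≤f = sumFin-mono n (λ s → if-≤ (inWindow d i (toℕ s)) (0≤f s))

windowSum-mono : ∀ {n} d (f : Fin n → ℚ) i i′ → (∀ s → 0ℚ ≤ f s) →
  (∀ (s : Fin n) → inWindow d i (toℕ s) ≡ true → inWindow d i′ (toℕ s) ≡ true) →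
  windowSum d f i ≤ windowSum d f i′
windowSum-mono {n} d f i i′ 0≤f i⊆i′ =
  sumFin-mono n (λ s → if-mono (inWindow d i (toℕ s)) (inWindow d i′ (toℕ s)) (0≤f s) (i⊆i′ s))

windowSum-prefix : ∀ {n} d (d≤n : d ℕ.≤ n) (f : Fin n → ℚ) →
  windowSum d f 0 ≡ sumFin d (λ c → f (F.inject≤ c d≤n))
windowSum-prefix {n} zero d≤n f = sumFin-zero n (λ _ → refl)
windowSum-prefix {suc n} (suc d) d≤n f = cong (f fzero +_) (windowSum-prefix d (ℕ.s≤s⁻¹ d≤n) (f ∘ fsuc))

windowSum-size : ∀ n d i → i ℕ.+ d ℕ.≤ n → windowSum {n} d (λ _ → 1ℚ) i ≡ sumFin d (λ _ → 1ℚ)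
windowSum-size n d zero d≤n = windowSum-prefix d d≤n (λ _ → 1ℚ)
windowSum-size (suc n) d (suc i) i+d<n = trans (ℚₚ.+-identityˡ _)
  (trans (sumFin-cong n (λ s → cong (λ c → if c then 1ℚ else 0ℚ) (inWindow-suc d i (toℕ s))))
         (windowSum-size n d i (ℕ.s≤s⁻¹ i+d<n)))

-- Sliding the window from i to i + 1 trades its first element for the one just beyond it.
window-slide-pointwise : ∀ d i k q → 1 ℕ.≤ d →
  (if inWindow d i k then q else 0ℚ) + (if (i ℕ.+ d) ℕ.≡ᵇ k then q else 0ℚ)
  ≡ (if inWindow d (suc i) k then q else 0ℚ) + (if i ℕ.≡ᵇ k then q else 0ℚ)
window-slide-pointwise d i k q 1≤d with ℕₚ.<-cmp i k
... | tri≈ _ refl _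
  rewrite inWindow-intro d i i ℕₚ.≤-refl (ℕₚ.m<m+n i 1≤d)
        | inWindow-before d (suc i) i (ℕₚ.<-irrefl refl)
        | ≢⇒≡ᵇ-false {i ℕ.+ d} {i} (λ e → ℕₚ.<-irrefl (sym e) (ℕₚ.m<m+n i 1≤d))
        | ≡⇒≡ᵇ-true {i} {i} refl = ℚₚ.+-comm q 0ℚ
... | tri> _ _ k<i
  rewrite inWindow-before d i k (ℕₚ.<⇒≱ k<i)
        | inWindow-before d (suc i) k (λ 1+i≤k → ℕₚ.<⇒≱ k<i (ℕₚ.≤-trans (ℕₚ.n≤1+n i) 1+i≤k))
        | ≢⇒≡ᵇ-false {i ℕ.+ d} {k} (λ e → ℕₚ.<⇒≱ k<i (subst (i ℕ.≤_) e (ℕₚ.m≤m+n i d)))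
        | ≢⇒≡ᵇ-false {i} {k} (λ e → ℕₚ.<-irrefl (sym e) k<i) = refl
... | tri< i<k _ _ with ℕₚ.<-cmp k (i ℕ.+ d)
...   | tri< k<i+d _ _
  rewrite inWindow-intro d i k (ℕₚ.<⇒≤ i<k) k<i+d
        | inWindow-intro d (suc i) k i<k (ℕₚ.m≤n⇒m≤1+n k<i+d)
        | ≢⇒≡ᵇ-false {i ℕ.+ d} {k} (λ e → ℕₚ.<-irrefl (sym e) k<i+d)
        | ≢⇒≡ᵇ-false {i} {k} (λ e → ℕₚ.<-irrefl e i<k) = refl
...   | tri≈ _ refl _
  rewrite inWindow-after d i (i ℕ.+ d) (ℕₚ.<-irrefl refl)
        | inWindow-intro d (suc i) (i ℕ.+ d) i<k (ℕₚ.n<1+n (i ℕ.+ d))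
        | ≡⇒≡ᵇ-true {i ℕ.+ d} {i ℕ.+ d} refl
        | ≢⇒≡ᵇ-false {i} {i ℕ.+ d} (λ e → ℕₚ.<-irrefl e i<k) = ℚₚ.+-comm 0ℚ q
...   | tri> _ _ i+d<k
  rewrite inWindow-after d i k (λ k<i+d → ℕₚ.<⇒≱ i+d<k (ℕₚ.<⇒≤ k<i+d))
        | inWindow-after d (suc i) k (λ k<1+i+d → ℕₚ.<⇒≱ i+d<k (ℕ.s≤s⁻¹ k<1+i+d))
        | ≢⇒≡ᵇ-false {i ℕ.+ d} {k} (λ e → ℕₚ.<-irrefl e i+d<k)
        | ≢⇒≡ᵇ-false {i} {k} (λ e → ℕₚ.<-irrefl e i<k) = refl

windowSum-slide : ∀ {n} d (f : Fin n → ℚ) i (s s′ : Fin n) → 1 ℕ.≤ d →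
  toℕ s ≡ i → toℕ s′ ≡ i ℕ.+ d → windowSum d f i + f s′ ≡ windowSum d f (suc i) + f s
windowSum-slide {n} d f i s s′ 1≤d s≡i s′≡i+d = begin
  windowSum d f i + f s′
    ≡⟨ cong (windowSum d f i +_) (sym (sumFin-select n f s′)) ⟩
  windowSum d f i + sumFin n (λ k → if s′ == k then f k else 0ℚ)
    ≡⟨ sym (sumFin-+ n _ _) ⟩
  sumFin n (λ k → (if inWindow d i (toℕ k) then f k else 0ℚ) + (if s′ == k then f k else 0ℚ))
    ≡⟨ sumFin-cong n (λ k → pointwise k) ⟩
  sumFin n (λ k → (if inWindow d (suc i) (toℕ k) then f k else 0ℚ) + (if s == k then f k else 0ℚ))
    ≡⟨ sumFin-+ n _ _ ⟩
  windowSum d f (suc i) + sumFin n (λ k → if s == k then f k else 0ℚ)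
    ≡⟨ cong (windowSum d f (suc i) +_) (sumFin-select n f s) ⟩
  windowSum d f (suc i) + f s ∎
  where
  open ≡-Reasoning
  pointwise : ∀ k → (if inWindow d i (toℕ k) then f k else 0ℚ) + (if s′ == k then f k else 0ℚ)
    ≡ (if inWindow d (suc i) (toℕ k) then f k else 0ℚ) + (if s == k then f k else 0ℚ)
  pointwise k rewrite s≡i | s′≡i+d = window-slide-pointwise d i (toℕ k) (f k) 1≤d

module Residues (n d : ℕ) (1≤d : 1 ℕ.≤ d) (d≤n : d ℕ.≤ n) where

  instance
    d≢0 : ℕ.NonZero d
    d≢0 = ℕ.>-nonZero 1≤d

  residue : Fin n → Fin d
  residue s = F.fromℕ< (ℕ.m%n<n (toℕ s) d)

  lift : Fin d → Fin n
  lift c = F.inject≤ c d≤n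

  toℕ-residue : ∀ s → toℕ (residue s) ≡ toℕ s % d
  toℕ-residue s = Fₚ.toℕ-fromℕ< (ℕ.m%n<n (toℕ s) d)

  residue-lift : ∀ c → residue (lift c) ≡ c
  residue-lift c = Fₚ.toℕ-injective (begin
    toℕ (residue (lift c))  ≡⟨ toℕ-residue (lift c) ⟩
    toℕ (lift c) % d        ≡⟨ cong (_% d) (Fₚ.toℕ-inject≤ c d≤n) ⟩
    toℕ c % d               ≡⟨ ℕ.m<n⇒m%n≡m (Fₚ.toℕ<n c) ⟩
    toℕ c                   ∎)
    where open ≡-Reasoning

  lift-residue : ∀ s → toℕ s ℕ.< d → lift (residue s) ≡ s
  lift-residue s s<d = Fₚ.toℕ-injective (begin
    toℕ (lift (residue s))  ≡⟨ Fₚ.toℕ-inject≤ (residue s) d≤n ⟩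
    toℕ (residue s)         ≡⟨ toℕ-residue s ⟩
    toℕ s % d               ≡⟨ ℕ.m<n⇒m%n≡m s<d ⟩
    toℕ s                   ∎)
    where open ≡-Reasoning

  residue-shift : ∀ s s′ → toℕ s′ ≡ toℕ s ℕ.+ d → residue s′ ≡ residue s
  residue-shift s s′ s′≡s+d = Fₚ.toℕ-injective (begin
    toℕ (residue s′)     ≡⟨ toℕ-residue s′ ⟩
    toℕ s′ % d           ≡⟨ cong (_% d) s′≡s+d ⟩
    (toℕ s ℕ.+ d) % d    ≡⟨ ℕ.[m+n]%n≡m%n (toℕ s) d ⟩
    toℕ s % d            ≡⟨ sym (toℕ-residue s) ⟩
    toℕ (residue s)      ∎)
    where open ≡-Reasoning

  Periodic : {A : Set} → (Fin n → A) → Set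
  Periodic f = ∀ s s′ → toℕ s′ ≡ toℕ s ℕ.+ d → f s ≡ f s′

  periodic-residue : ∀ {A : Set} (f : Fin n → A) → Periodic f → ∀ s → f s ≡ f (lift (residue s))
  periodic-residue f periodic s = reduce n s (Fₚ.toℕ<n s)
    where
    reduce : ∀ fuel s → toℕ s ℕ.< fuel → f s ≡ f (lift (residue s))
    reduce (suc fuel) s s<1+fuel with toℕ s ℕ.<? d
    ... | yes s<d = cong f (sym (lift-residue s s<d))
    ... | no s≮d = begin
      f s                        ≡⟨ sym (periodic s₋ s s≡s₋+d) ⟩
      f s₋                       ≡⟨ reduce fuel s₋ s₋<fuel ⟩
      f (lift (residue s₋))      ≡⟨ cong (f ∘ lift) (sym (residue-shift s₋ s s≡s₋+d)) ⟩
      f (lift (residue s))       ∎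
      where
      open ≡-Reasoning
      s-d<n : toℕ s ∸ d ℕ.< n
      s-d<n = ℕₚ.≤-<-trans (ℕₚ.m∸n≤m (toℕ s) d) (Fₚ.toℕ<n s)
      s₋ : Fin n
      s₋ = F.fromℕ< s-d<n
      s≡s₋+d : toℕ s ≡ toℕ s₋ ℕ.+ d
      s≡s₋+d = trans (sym (ℕₚ.m∸n+n≡m (ℕₚ.≮⇒≥ s≮d)))
                     (cong (ℕ._+ d) (sym (Fₚ.toℕ-fromℕ< s-d<n)))
      s₋<fuel : toℕ s₋ ℕ.< fuel
      s₋<fuel = ℕₚ.<-≤-trans (ℕₚ.m<m+n (toℕ s₋) 1≤d)
                              (subst (ℕ._≤ fuel) s≡s₋+d (ℕ.s≤s⁻¹ s<1+fuel))

  windows-constant⇒periodic : ∀ (f : Fin n → ℚ) c →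
    (∀ i → i ℕ.+ d ℕ.≤ n → windowSum d f i ≡ c) → Periodic f
  windows-constant⇒periodic f c constant s s′ s′≡s+d = +-cancelˡ c (f s) (f s′) (begin
    c + f s                            ≡⟨ cong (_+ f s) (sym (constant (suc (toℕ s)) 1+s+d≤n)) ⟩
    windowSum d f (suc (toℕ s)) + f s  ≡⟨ sym (windowSum-slide d f (toℕ s) s s′ 1≤d refl s′≡s+d) ⟩
    windowSum d f (toℕ s) + f s′       ≡⟨ cong (_+ f s′) (constant (toℕ s) (ℕₚ.<⇒≤ 1+s+d≤n)) ⟩
    c + f s′                           ∎)
    where
    open ≡-Reasoning
    1+s+d≤n : suc (toℕ s) ℕ.+ d ℕ.≤ n
    1+s+d≤n = subst (ℕ._< n) s′≡s+d (Fₚ.toℕ<n s′)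

  periodic⇒windows-constant : ∀ (f : Fin n → ℚ) → Periodic f →
    ∀ i → i ℕ.+ d ℕ.≤ n → windowSum d f i ≡ windowSum d f 0
  periodic⇒windows-constant f periodic zero _ = refl
  periodic⇒windows-constant f periodic (suc i) 1+i+d≤n = begin
    windowSum d f (suc i)  ≡⟨ sym (+-cancelʳ (windowSum d f i) (windowSum d f (suc i)) (f s′) slide) ⟩
    windowSum d f i        ≡⟨ periodic⇒windows-constant f periodic i (ℕₚ.<⇒≤ 1+i+d≤n) ⟩
    windowSum d f 0        ∎
    where
    open ≡-Reasoning
    i<n : i ℕ.< n
    i<n = ℕₚ.<-≤-trans (ℕ.s≤s (ℕₚ.m≤m+n i d)) 1+i+d≤n
    s s′ : Fin n
    s = F.fromℕ< i<n
    s′ = F.fromℕ< 1+i+d≤n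
    s′≡s+d : toℕ s′ ≡ toℕ s ℕ.+ d
    s′≡s+d = trans (Fₚ.toℕ-fromℕ< 1+i+d≤n) (cong (ℕ._+ d) (sym (Fₚ.toℕ-fromℕ< i<n)))
    slide : windowSum d f i + f s′ ≡ windowSum d f (suc i) + f s′
    slide = trans (windowSum-slide d f i s s′ 1≤d (Fₚ.toℕ-fromℕ< i<n) (Fₚ.toℕ-fromℕ< 1+i+d≤n))
                  (cong (windowSum d f (suc i) +_) (periodic s s′ s′≡s+d))

vertex-rigid : ∀ {G} {P : Vect G → Set} {x} → IsVertex G P x → ∀ ε (D : Vect G) → 0ℚ < ε →
  P (λ s t → x s t + ε * D s t) → P (λ s t → x s t + ε * - D s t) → ∀ s t → D s t ≡ 0ℚ
vertex-rigid {x = x} (_ , extreme) ε D 0<ε P₊ P₋ s t = *-cancel-pos ε (D s t) 0<ε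
  (+-cancelˡ (x s t) (ε * D s t) 0ℚ
    (trans (extreme _ _ ½ P₊ P₋ (ℚₚ.positive⁻¹ ½) (toWitness {a? = ½ ℚ.<? 1ℚ} tt) midpoint s t)
           (sym (ℚₚ.+-identityʳ (x s t)))))
  where
  midpoint : ∀ s t → x s t ≡ ½ * (x s t + ε * D s t) + (1ℚ - ½) * (x s t + ε * - D s t)
  midpoint s t = solve 3 (λ x e d → x := con ½ :* (x :+ e :* d) :+ con ½ :* (x :+ e :* (:- d)))
    refl (x s t) ε (D s t)

module Feasibility (G : BipGraph) (d : ℕ) where

  onE-supported : ∀ {y : Vect G} → SupportedOnE G y → ∀ s t → onE G s t (y s t) ≡ y s t
  onE-supported {y} supported s t with adj G s t in s~t
  ... | true = refl
  ... | false = sym (supported s t s~t)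

  window-constraint≡windowSum : ∀ {y : Vect G} → SupportedOnE G y → ∀ (s : Fin (nS G)) t →
    sumFin (nS G) (λ s′ → if inWindow d (toℕ s) (toℕ s′) then onE G s′ t (y s′ t) else 0ℚ)
    ≡ windowSum {nS G} d (λ s′ → y s′ t) (toℕ s)
  window-constraint≡windowSum supported s t = sumFin-cong (nS G) (λ s′ →
    cong (λ q → if inWindow d (toℕ s) (toℕ s′) then q else 0ℚ) (onE-supported supported s′ t))

  feasible⇒row≡1 : ∀ {y} → FeasibleLP2 G d y → ∀ s → rowSum y s ≡ 1ℚ
  feasible⇒row≡1 (supported , _ , rows , _) s =
    trans (sumFin-cong (nT G) (λ t → sym (onE-supported supported s t))) (rows s)

  feasible⇒window≤1 : ∀ {y} → FeasibleLP2 G d y → ∀ i → i ℕ.< nS G → ∀ t →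
    windowSum {nS G} d (λ s → y s t) i ≤ 1ℚ
  feasible⇒window≤1 {y} (supported , _ , _ , windows) i i<n t =
    subst (λ j → windowSum {nS G} d (λ s → y s t) j ≤ 1ℚ) (Fₚ.toℕ-fromℕ< i<n)
      (subst (_≤ 1ℚ) (window-constraint≡windowSum {y} supported (F.fromℕ< i<n) t) (windows (F.fromℕ< i<n) t))

  feasible-intro : ∀ {y} → SupportedOnE G y → (∀ s t → 0ℚ ≤ y s t) → (∀ s → rowSum y s ≡ 1ℚ) →
    (∀ i → i ℕ.< nS G → ∀ t → windowSum {nS G} d (λ s → y s t) i ≤ 1ℚ) → FeasibleLP2 G d y
  feasible-intro {y} supported y≥0 rows windows =
    supported , y≥0 ,
    (λ s → trans (sumFin-cong (nT G) (onE-supported supported s)) (rows s)) ,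
    (λ s t → subst (_≤ 1ℚ) (sym (window-constraint≡windowSum {y} supported s t))
               (windows (toℕ s) (Fₚ.toℕ<n s) t))

module VertexOfLP2 (G : BipGraph) (x : Vect G) (vertex : IsVertex G (FeasibleLP2 G (nT G)) x) where

  n m : ℕ
  n = nS G
  m = nT G

  open Feasibility G m

  x≥0 : ∀ s t → 0ℚ ≤ x s t
  x≥0 = proj₁ (proj₂ (proj₁ vertex))

  row≡1 : ∀ s → rowSum x s ≡ 1ℚ
  row≡1 = feasible⇒row≡1 (proj₁ vertex)

  window≤1 : ∀ i → i ℕ.< n → ∀ t → windowSum m (λ s → x s t) i ≤ 1ℚ
  window≤1 = feasible⇒window≤1 (proj₁ vertex)

  perturbation-feasible : (E : Vect G) → (∀ s t → 0ℚ ≤ x s t + E s t) → (∀ s → rowSum E s ≡ 0ℚ) →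
    (∀ s t → x s t ≡ 0ℚ → E s t ≡ 0ℚ) →
    (∀ i → i ℕ.< n → ∀ t → windowSum m (λ s → x s t + E s t) i ≤ 1ℚ) →
    FeasibleLP2 G m (λ s t → x s t + E s t)
  perturbation-feasible E y≥0 E-rows E-support windows = feasible-intro supported y≥0 rows windows
    where
    supported : SupportedOnE G (λ s t → x s t + E s t)
    supported s t ¬s~t = let x≡0 = proj₁ (proj₁ vertex) s t ¬s~t in
      trans (cong₂ _+_ x≡0 (E-support s t x≡0)) (ℚₚ.+-identityˡ 0ℚ)
    rows : ∀ s → rowSum (λ s t → x s t + E s t) s ≡ 1ℚ
    rows s = trans (sumFin-+ m (x s) (E s)) (trans (cong₂ _+_ (row≡1 s) (E-rows s)) (ℚₚ.+-identityʳ 1ℚ))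

  -- Both cases present x as X ∘ π for a point X of the matching polytope.
  module Reduction {a : ℕ} (X : Fin a → Fin m → ℚ) (π : Fin n → Fin a) (ι : Fin a → Fin n)
    (π∘ι : ∀ c → π (ι c) ≡ c) (x≡X∘π : ∀ s t → x s t ≡ X (π s) t)
    (colX≤1 : ∀ t → colSum X t ≤ 1ℚ)
    (lifted-windows : ∀ E → Perturbation.Admissible X E → ∀ i → i ℕ.< n → ∀ t →
                        windowSum m (λ s → x s t + E (π s) t) i ≤ 1ℚ) where

    open Perturbation X

    X≡x∘ι : ∀ c t → X c t ≡ x (ι c) t
    X≡x∘ι c t = trans (cong (λ c → X c t) (sym (π∘ι c))) (sym (x≡X∘π (ι c) t))

    X≥0 : ∀ c t → 0ℚ ≤ X c t
    X≥0 c t = subst (0ℚ ≤_) (sym (X≡x∘ι c t)) (x≥0 (ι c) t)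

    rowX≡1 : ∀ c → rowSum X c ≡ 1ℚ
    rowX≡1 c = trans (sumFin-cong m (X≡x∘ι c)) (row≡1 (ι c))

    lift-admissible : ∀ {E} → Admissible E → FeasibleLP2 G m (λ s t → x s t + E (π s) t)
    lift-admissible {E} admissible = perturbation-feasible (λ s t → E (π s) t)
      (λ s t → subst (λ q → 0ℚ ≤ q + E (π s) t) (sym (x≡X∘π s t)) (nonNeg (π s) t))
      (λ s → row-balanced (π s))
      (λ s t x≡0 → support (π s) t (trans (sym (x≡X∘π s t)) x≡0))
      (lifted-windows E admissible)
      where open Admissible admissible

    X-not-fractional : ∀ c t → ¬ Fractional (X c t)
    X-not-fractional c t frac with AlternatingWalk.direction-through X X≥0 rowX≡1 colX≤1 c t frac
    ... | L , D , direction , c′ , t′ , D≢0 = D≢0 (begin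
      D c′ t′          ≡⟨ cong (λ c → D c t′) (sym (π∘ι c′)) ⟩
      D (π (ι c′)) t′  ≡⟨ vertex-rigid {G} {FeasibleLP2 G m} vertex ε (λ s t → D (π s) t) 0<ε
                            (lift-admissible (direction-admissible X≥0 colX≤1 direction))
                            (lift-admissible (direction-admissible X≥0 colX≤1 (neg-direction direction)))
                            (ι c′) t′ ⟩
      0ℚ               ∎)
      where
      open Step L
      open ≡-Reasoning

  module FewRows (n<m : n ℕ.< m) (0<n : 0 ℕ.< n) where

    colx≤1 : ∀ t → colSum x t ≤ 1ℚ
    colx≤1 t = subst (_≤ 1ℚ) (windowSum-whole m (λ s → x s t) (ℕₚ.<⇒≤ n<m)) (window≤1 0 0<n t)

    open Reduction x (λ s → s) (λ s → s) (λ _ → refl) (λ _ _ → refl) colx≤1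
      (λ E admissible i _ t → ℚₚ.≤-trans
         (windowSum-≤-sumFin m _ i (λ s → Perturbation.Admissible.nonNeg admissible s t))
         (Perturbation.Admissible.col≤1 admissible t))
      public

  module ManyRows (m≤n : m ℕ.≤ n) (1≤m : 1 ℕ.≤ m) where

    open Residues n m 1≤m m≤n

    -- A full window holds m rows of total mass m spread over m columns of capacity 1.
    full-window≡1 : ∀ i → i ℕ.+ m ℕ.≤ n → ∀ t → windowSum m (λ s → x s t) i ≡ 1ℚ
    full-window≡1 i i+m≤n =
      sumFin-mono-≡ m (window≤1 i (ℕₚ.<-≤-trans (ℕₚ.m<m+n i 1≤m) i+m≤n)) (begin
      sumFin m (λ t → windowSum m (λ s → x s t) i)
        ≡⟨ sym (sumFin-comm n m (λ s t → if inWindow m i (toℕ s) then x s t else 0ℚ)) ⟩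
      sumFin n (λ s → sumFin m (λ t → if inWindow m i (toℕ s) then x s t else 0ℚ))
        ≡⟨ sumFin-cong n (λ s → trans (sumFin-if m (inWindow m i (toℕ s)) (x s))
             (cong (λ q → if inWindow m i (toℕ s) then q else 0ℚ) (row≡1 s))) ⟩
      windowSum {n} m (λ _ → 1ℚ) i
        ≡⟨ windowSum-size n m i i+m≤n ⟩
      sumFin m (λ _ → 1ℚ) ∎)
      where open ≡-Reasoning

    x-periodic : ∀ t → Periodic (λ s → x s t)
    x-periodic t = windows-constant⇒periodic (λ s → x s t) 1ℚ (λ i i+m≤n → full-window≡1 i i+m≤n t)

    X : Fin m → Fin m → ℚ
    X c t = x (lift c) t

    x≡X∘residue : ∀ s t → x s t ≡ X (residue s) t
    x≡X∘residue s t = periodic-residue (λ s → x s t) (x-periodic t) s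

    colX≡1 : ∀ t → colSum X t ≡ 1ℚ
    colX≡1 t = trans (sym (windowSum-prefix m m≤n (λ s → x s t))) (full-window≡1 0 m≤n t)

    module Lifted (E : Fin m → Fin m → ℚ) (admissible : Perturbation.Admissible X E) (t : Fin m) where

      open Perturbation.Admissible admissible

      y : Fin n → ℚ
      y s = x s t + E (residue s) t

      y≥0 : ∀ s → 0ℚ ≤ y s
      y≥0 s = subst (λ q → 0ℚ ≤ q + E (residue s) t) (sym (x≡X∘residue s t)) (nonNeg (residue s) t)

      y-periodic : Periodic y
      y-periodic s s′ s′≡s+m = cong₂ _+_ (x-periodic t s s′ s′≡s+m)
        (cong (λ c → E c t) (sym (residue-shift s s′ s′≡s+m)))

      full-window≤1 : ∀ i → i ℕ.+ m ℕ.≤ n → windowSum m y i ≤ 1ℚ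
      full-window≤1 i i+m≤n = begin
        windowSum m y i
          ≡⟨ periodic⇒windows-constant y y-periodic i i+m≤n ⟩
        windowSum m y 0
          ≡⟨ windowSum-prefix m m≤n y ⟩
        sumFin m (λ c → X c t + E (residue (lift c)) t)
          ≡⟨ sumFin-cong m (λ c → cong (λ c′ → X c t + E c′ t) (residue-lift c)) ⟩
        colSum (λ c t → X c t + E c t) t
          ≤⟨ col≤1 t ⟩
        1ℚ ∎
        where open ℚₚ.≤-Reasoning

      -- A window running past the last row only sees rows of the last full window.
      y-window≤1 : ∀ i → windowSum m y i ≤ 1ℚ
      y-window≤1 i with i ℕ.+ m ℕ.≤? n
      ... | yes i+m≤n = full-window≤1 i i+m≤n
      ... | no i+m≰n = ℚₚ.≤-trans (windowSum-mono m y i (n ∸ m) y≥0 within-last)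
                                  (full-window≤1 (n ∸ m) (ℕₚ.≤-reflexive (ℕₚ.m∸n+n≡m m≤n)))
        where
        n-m≤i : n ∸ m ℕ.≤ i
        n-m≤i = subst (n ∸ m ℕ.≤_) (ℕₚ.m+n∸n≡m i m)
                  (ℕₚ.∸-monoˡ-≤ m (ℕₚ.<⇒≤ (ℕₚ.≰⇒> i+m≰n)))
        within-last : ∀ (s : Fin n) → inWindow m i (toℕ s) ≡ true → inWindow m (n ∸ m) (toℕ s) ≡ true
        within-last s inside = inWindow-intro m (n ∸ m) (toℕ s)
          (ℕₚ.≤-trans n-m≤i (proj₁ (inWindow-elim m i (toℕ s) inside)))
          (subst (toℕ s ℕ.<_) (sym (ℕₚ.m∸n+n≡m m≤n)) (Fₚ.toℕ<n s))

    open Reduction X residue lift residue-lift x≡X∘residue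
      (λ t → ℚₚ.≤-reflexive (colX≡1 t))
      (λ E admissible i _ t → Lifted.y-window≤1 E admissible t i)
      public

    x-not-fractional : ∀ s t → ¬ Fractional (x s t)
    x-not-fractional s t = X-not-fractional (residue s) t ∘ subst Fractional (x≡X∘residue s t)

  x-not-fractional : ∀ s t → ¬ Fractional (x s t)
  x-not-fractional s t with m ℕ.≤? n
  ... | yes m≤n = ManyRows.x-not-fractional m≤n (ℕₚ.≤-<-trans ℕ.z≤n (Fₚ.toℕ<n t)) s t
  ... | no m≰n = FewRows.X-not-fractional (ℕₚ.≰⇒> m≰n) (ℕₚ.≤-<-trans ℕ.z≤n (Fₚ.toℕ<n s)) s t

  x-binary : ∀ s t → x s t ≡ 0ℚ ⊎ x s t ≡ 1ℚ
  x-binary s t = unit-interval-not-fractional (x≥0 s t)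
    (subst (x s t ≤_) (row≡1 s) (≤-sumFin m (x≥0 s) t)) (x-not-fractional s t)

theorem5 : (G : BipGraph) → LP2Integral G (nT G)
theorem5 G x vertex s t with VertexOfLP2.x-binary G x vertex s t
... | inj₁ x≡0 = ℤ.+ 0 , x≡0
... | inj₂ x≡1 = ℤ.+ 1 , x≡1
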